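{- Any two coverage functions $\varphi_1\colon 2^{S_1}\to\mathbb{R}_+$ and $\varphi_2\colon 2^{S_2}\to\mathbb{R}_+$ on finite sets $S_1,S_2$ have a tensor product $\varphi\colon 2^{S_1\times S_2}\to\mathbb{R}_+$ which is a coverage function.
   Context: A coverage function is a function of the form $\varphi(X)=\sum_{t\in N(X)}w_t$ for a bipartite graph $G=(S,T;E)$ and weights $w\in\mathbb{R}_+^T$, where $N(X)$ is the neighbourhood of $X$ in $G$. A tensor product of $\varphi_1,\varphi_2$ is a function $\varphi$ with $\varphi(X_1\times X_2)=\varphi_1(X_1)\varphi_2(X_2)$ for all $X_1\subseteq S_1$, $X_2\subseteq S_2$. -}

module Defs where

open import Level using (_⊔_)
open import Data.Nat using (ℕ; zero; suc; _*_)
open import Data.Fin using (Fin; zero; suc; remQuot)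
open import Data.Bool using (Bool; _∧_; if_then_else_)
open import Data.List using (allFin)
open import Data.Bool.ListAction using (any)
open import Data.Product using (Σ; _,_)
open import Algebra.Bundles using (CommutativeSemiring)

SubsetOf : ℕ → Set
SubsetOf n = Fin n → Bool

module _ {c ℓ} (R : CommutativeSemiring c ℓ) where
  open CommutativeSemiring R using (Carrier; _≈_; _+_; 0#)

  sumR : ∀ {m} → (Fin m → Carrier) → Carrier
  sumR {zero}  f = 0#
  sumR {suc m} f = f zero + sumR (λ t → f (suc t))

  -- Bipartite graph G = (Fin n, Fin m; E), edges given by E s t.
  -- inN E X t  :  t ∈ N(X), i.e. some s ∈ X is adjacent to t.
  inN : ∀ {n m} → (Fin n → Fin m → Bool) → SubsetOf n → Fin m → Bool
  inN {n} E X t = any (λ s → X s ∧ E s t) (allFin n)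

  coverage : ∀ {n m} → (Fin n → Fin m → Bool) → (Fin m → Carrier) →
             SubsetOf n → Carrier
  coverage E w X = sumR (λ t → if inN E X t then w t else 0#)

  IsCoverage : ∀ {n} → (SubsetOf n → Carrier) → Set (c ⊔ ℓ)
  IsCoverage {n} φ =
    Σ ℕ λ m → Σ (Fin n → Fin m → Bool) λ E → Σ (Fin m → Carrier) λ w →
      ∀ X → φ X ≈ coverage E w X

-- S₁ × S₂ for S₁ = Fin n₁, S₂ = Fin n₂ is encoded as Fin (n₁ * n₂)
-- via the standard bijection remQuot / combine.
-- The product set X₁ × X₂ ⊆ S₁ × S₂:
_⊠_ : ∀ {n₁ n₂} → SubsetOf n₁ → SubsetOf n₂ → SubsetOf (n₁ * n₂)
_⊠_ {n₁} {n₂} X₁ X₂ k with remQuot {n₁} n₂ k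
... | (i , j) = X₁ i ∧ X₂ j

-- Realise φ₁ and φ₂ by graphs (S₁, T₁; E₁), (S₂, T₂; E₂) with weights w₁, w₂, and take the
-- product graph on (S₁ × S₂, T₁ × T₂), where (s₁, s₂) ~ (t₁, t₂) iff s₁ ~ t₁ and s₂ ~ t₂,
-- with weights w₁ t₁ · w₂ t₂. Then (t₁, t₂) ∈ N(X₁ × X₂) iff t₁ ∈ N(X₁) and t₂ ∈ N(X₂),
-- so the coverage sum over T₁ × T₂ factors into the product of the two coverage sums.
module Submission where

open import Defs
open import Level using (Level)
open import Data.Nat as ℕ using (ℕ; zero; suc)
open import Data.Fin using (Fin; zero; suc; _↑ˡ_; _↑ʳ_; combine; remQuot)
open import Data.Fin.Properties using (remQuot-combine)
open import Data.Product using (_,_; uncurry)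
open import Data.Bool using (Bool; true; false; _∧_; _∨_; if_then_else_)
open import Data.Bool.Properties using (∨-∧-commutativeSemiring; ∧-commutativeMonoid)
open import Data.Bool.ListAction using (any)
open import Data.List using (tabulate)
open import Data.Vec.Functional using (Vector)
open import Algebra.Bundles using (Monoid; Semiring; CommutativeMonoid; CommutativeSemiring)
import Algebra.Properties.CommutativeSemigroup as CommutativeSemigroupProperties
import Algebra.Properties.Monoid.Sum as MonoidSum
import Algebra.Properties.Semiring.Sum as SemiringSum
open import Function using (_∘_)
open import Relation.Binary.PropositionalEquality as ≡ using (_≡_; module ≡-Reasoning)
import Relation.Binary.Reasoning.Setoid as SetoidReasoning

private
  variable
    a : Level
    A : Set a
    n₁ n₂ m₁ m₂ : ℕ

onPairs : (Fin n₁ → Fin n₂ → A) → Fin (n₁ ℕ.* n₂) → A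
onPairs {n₂ = n₂} f k = uncurry f (remQuot n₂ k)

onPairs-combine : (f : Fin n₁ → Fin n₂ → A) (i : Fin n₁) (j : Fin n₂) →
                  onPairs f (combine i j) ≡ f i j
onPairs-combine {n₁ = n₁} {n₂ = n₂} f i j = ≡.cong (uncurry f) (remQuot-combine {n₁} {n₂} i j)

⊠-combine : (X₁ : SubsetOf n₁) (X₂ : SubsetOf n₂) (i : Fin n₁) (j : Fin n₂) →
            (X₁ ⊠ X₂) (combine i j) ≡ (X₁ i ∧ X₂ j)
⊠-combine X₁ X₂ = onPairs-combine (λ i j → X₁ i ∧ X₂ j)

module MonoidSumProperties {c ℓ} (M : Monoid c ℓ) where
  open Monoid M renaming (_∙_ to _+_)
  open MonoidSum M using (sum; sum-syntax)
  open SetoidReasoning setoid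

  sum-↑ : ∀ k l (f : Vector Carrier (k ℕ.+ l)) →
          sum f ≈ sum (λ i → f (i ↑ˡ l)) + sum (λ j → f (k ↑ʳ j))
  sum-↑ zero    l f = sym (identityˡ _)
  sum-↑ (suc k) l f = begin
    f zero + sum (f ∘ suc)
      ≈⟨ ∙-congˡ (sum-↑ k l (f ∘ suc)) ⟩
    f zero + (sum (λ i → f (suc (i ↑ˡ l))) + sum (λ j → f (suc (k ↑ʳ j))))
      ≈⟨ sym (assoc _ _ _) ⟩
    (f zero + sum (λ i → f (suc (i ↑ˡ l)))) + sum (λ j → f (suc (k ↑ʳ j))) ∎

  sum-combine : ∀ m n (f : Vector Carrier (m ℕ.* n)) →
                sum f ≈ ∑[ i < m ] ∑[ j < n ] f (combine i j)
  sum-combine zero    n f = refl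
  sum-combine (suc m) n f =
    trans (sum-↑ n (m ℕ.* n) f) (∙-congˡ (sum-combine m n (f ∘ (n ↑ʳ_))))

module SemiringSumProperties {c ℓ} (R : Semiring c ℓ) where
  open Semiring R
  open SemiringSum R using (sum; sum-syntax; sum-cong-≋; *-distribˡ-sum; *-distribʳ-sum)
  open MonoidSumProperties +-monoid public

  sum-*-sum : ∀ {m n} (f : Vector Carrier m) (g : Vector Carrier n) →
              sum f * sum g ≈ ∑[ i < m ] ∑[ j < n ] (f i * g j)
  sum-*-sum f g = trans (*-distribʳ-sum (sum g) f) (sum-cong-≋ (λ i → *-distribˡ-sum (f i) g))

  if-∧-* : ∀ b₁ b₂ x y →
           (if b₁ ∧ b₂ then x * y else 0#) ≈ (if b₁ then x else 0#) * (if b₂ then y else 0#)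
  if-∧-* true  true  x y = refl
  if-∧-* true  false x y = sym (zeroʳ x)
  if-∧-* false b₂    x y = sym (zeroˡ _)

sumR≡sum : ∀ {c ℓ} (R : CommutativeSemiring c ℓ) {m}
           (f : Vector (CommutativeSemiring.Carrier R) m) →
           sumR R f ≡ SemiringSum.sum (CommutativeSemiring.semiring R) f
sumR≡sum R {zero}  f = ≡.refl
sumR≡sum R {suc m} f = ≡.cong (CommutativeSemiring._+_ R (f zero)) (sumR≡sum R (f ∘ suc))

-- Neighbourhood membership is a sum in the Boolean semiring (∨, ∧), so the sum lemmas apply to it.
module BoolSum = SemiringSumProperties (CommutativeSemiring.semiring ∨-∧-commutativeSemiring)
open SemiringSum (CommutativeSemiring.semiring ∨-∧-commutativeSemiring)
  using () renaming (sum to ⋁; sum-cong-≋ to ⋁-cong)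

any-tabulate : ∀ {n} (p : A → Bool) (g : Fin n → A) → any p (tabulate g) ≡ ⋁ (p ∘ g)
any-tabulate {n = zero}  p g = ≡.refl
any-tabulate {n = suc n} p g = ≡.cong (p (g zero) ∨_) (any-tabulate p (g ∘ suc))

inN≡⋁ : ∀ {c ℓ} (R : CommutativeSemiring c ℓ)
        (E : Fin n₁ → Fin m₁ → Bool) (X : SubsetOf n₁) t →
        inN R E X t ≡ ⋁ (λ s → X s ∧ E s t)
inN≡⋁ R E X t = any-tabulate (λ s → X s ∧ E s t) (λ s → s)

open CommutativeSemigroupProperties (CommutativeMonoid.commutativeSemigroup ∧-commutativeMonoid)
  using () renaming (interchange to ∧-interchange)

_⊠ᴱ_ : (Fin n₁ → Fin m₁ → Bool) → (Fin n₂ → Fin m₂ → Bool) →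
       Fin (n₁ ℕ.* n₂) → Fin (m₁ ℕ.* m₂) → Bool
E₁ ⊠ᴱ E₂ = onPairs (λ s₁ s₂ → onPairs (λ t₁ t₂ → E₁ s₁ t₁ ∧ E₂ s₂ t₂))

⊠ᴱ-combine : (E₁ : Fin n₁ → Fin m₁ → Bool) (E₂ : Fin n₂ → Fin m₂ → Bool) →
             ∀ s₁ s₂ t₁ t₂ →
             (E₁ ⊠ᴱ E₂) (combine s₁ s₂) (combine t₁ t₂) ≡ (E₁ s₁ t₁ ∧ E₂ s₂ t₂)
⊠ᴱ-combine E₁ E₂ s₁ s₂ t₁ t₂ =
  ≡.trans (≡.cong-app (onPairs-combine (λ s₁ s₂ → onPairs (λ t₁ t₂ → E₁ s₁ t₁ ∧ E₂ s₂ t₂)) s₁ s₂)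
                      (combine t₁ t₂))
          (onPairs-combine (λ t₁ t₂ → E₁ s₁ t₁ ∧ E₂ s₂ t₂) t₁ t₂)

inN-⊠ : ∀ {c ℓ} (R : CommutativeSemiring c ℓ)
        (E₁ : Fin n₁ → Fin m₁ → Bool) (E₂ : Fin n₂ → Fin m₂ → Bool)
        (X₁ : SubsetOf n₁) (X₂ : SubsetOf n₂) t₁ t₂ →
        inN R (E₁ ⊠ᴱ E₂) (X₁ ⊠ X₂) (combine t₁ t₂) ≡ (inN R E₁ X₁ t₁ ∧ inN R E₂ X₂ t₂)
inN-⊠ {n₁ = n₁} {n₂ = n₂} R E₁ E₂ X₁ X₂ t₁ t₂ = begin
  inN R (E₁ ⊠ᴱ E₂) (X₁ ⊠ X₂) (combine t₁ t₂)
    ≡⟨ inN≡⋁ R (E₁ ⊠ᴱ E₂) (X₁ ⊠ X₂) (combine t₁ t₂) ⟩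
  ⋁ (λ s → (X₁ ⊠ X₂) s ∧ (E₁ ⊠ᴱ E₂) s (combine t₁ t₂))
    ≡⟨ BoolSum.sum-combine n₁ n₂ _ ⟩
  ⋁ (λ (s₁ : Fin n₁) → ⋁ (λ (s₂ : Fin n₂) →
      (X₁ ⊠ X₂) (combine s₁ s₂) ∧ (E₁ ⊠ᴱ E₂) (combine s₁ s₂) (combine t₁ t₂)))
    ≡⟨ ⋁-cong (λ s₁ → ⋁-cong (factor s₁)) ⟩
  ⋁ (λ (s₁ : Fin n₁) → ⋁ (λ (s₂ : Fin n₂) → (X₁ s₁ ∧ E₁ s₁ t₁) ∧ (X₂ s₂ ∧ E₂ s₂ t₂)))
    ≡⟨ ≡.sym (BoolSum.sum-*-sum (λ s₁ → X₁ s₁ ∧ E₁ s₁ t₁) (λ s₂ → X₂ s₂ ∧ E₂ s₂ t₂)) ⟩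
  ⋁ (λ s₁ → X₁ s₁ ∧ E₁ s₁ t₁) ∧ ⋁ (λ s₂ → X₂ s₂ ∧ E₂ s₂ t₂)
    ≡⟨ ≡.sym (≡.cong₂ _∧_ (inN≡⋁ R E₁ X₁ t₁) (inN≡⋁ R E₂ X₂ t₂)) ⟩
  inN R E₁ X₁ t₁ ∧ inN R E₂ X₂ t₂ ∎
  where
  open ≡-Reasoning
  factor : ∀ s₁ s₂ → ((X₁ ⊠ X₂) (combine s₁ s₂) ∧ (E₁ ⊠ᴱ E₂) (combine s₁ s₂) (combine t₁ t₂))
                     ≡ ((X₁ s₁ ∧ E₁ s₁ t₁) ∧ (X₂ s₂ ∧ E₂ s₂ t₂))
  factor s₁ s₂ = ≡.trans (≡.cong₂ _∧_ (⊠-combine X₁ X₂ s₁ s₂) (⊠ᴱ-combine E₁ E₂ s₁ s₂ t₁ t₂))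
                         (∧-interchange (X₁ s₁) (X₂ s₂) (E₁ s₁ t₁) (E₂ s₂ t₂))

module Tensor {c ℓ} (R : CommutativeSemiring c ℓ) where
  open CommutativeSemiring R
  open SemiringSumProperties semiring
  open SemiringSum semiring using (sum; sum-syntax; sum-cong-≋)
  open SetoidReasoning setoid

  _⊗ʷ_ : Vector Carrier m₁ → Vector Carrier m₂ → Vector Carrier (m₁ ℕ.* m₂)
  w₁ ⊗ʷ w₂ = onPairs (λ t₁ t₂ → w₁ t₁ * w₂ t₂)

  coverage-⊠ : (E₁ : Fin n₁ → Fin m₁ → Bool) (E₂ : Fin n₂ → Fin m₂ → Bool)
               (w₁ : Vector Carrier m₁) (w₂ : Vector Carrier m₂)
               (X₁ : SubsetOf n₁) (X₂ : SubsetOf n₂) →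
               coverage R (E₁ ⊠ᴱ E₂) (w₁ ⊗ʷ w₂) (X₁ ⊠ X₂)
                 ≈ coverage R E₁ w₁ X₁ * coverage R E₂ w₂ X₂
  coverage-⊠ {m₁ = m₁} {m₂ = m₂} E₁ E₂ w₁ w₂ X₁ X₂ = begin
    coverage R (E₁ ⊠ᴱ E₂) (w₁ ⊗ʷ w₂) (X₁ ⊠ X₂)
      ≡⟨ sumR≡sum R {m₁ ℕ.* m₂} _ ⟩
    sum (λ t → if inN R (E₁ ⊠ᴱ E₂) (X₁ ⊠ X₂) t then (w₁ ⊗ʷ w₂) t else 0#)
      ≈⟨ sum-combine m₁ m₂ _ ⟩
    ∑[ t₁ < m₁ ] ∑[ t₂ < m₂ ]
      (if inN R (E₁ ⊠ᴱ E₂) (X₁ ⊠ X₂) (combine t₁ t₂) then (w₁ ⊗ʷ w₂) (combine t₁ t₂) else 0#)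
      ≈⟨ sum-cong-≋ (λ t₁ → sum-cong-≋ (term-factor t₁)) ⟩
    ∑[ t₁ < m₁ ] ∑[ t₂ < m₂ ] (covered₁ t₁ * covered₂ t₂)
      ≈⟨ sum-*-sum covered₁ covered₂ ⟨
    sum covered₁ * sum covered₂
      ≡⟨ ≡.cong₂ _*_ (sumR≡sum R covered₁) (sumR≡sum R covered₂) ⟨
    coverage R E₁ w₁ X₁ * coverage R E₂ w₂ X₂ ∎
    where
    covered₁ : Vector Carrier m₁
    covered₁ t₁ = if inN R E₁ X₁ t₁ then w₁ t₁ else 0#
    covered₂ : Vector Carrier m₂
    covered₂ t₂ = if inN R E₂ X₂ t₂ then w₂ t₂ else 0#

    term-factor : ∀ t₁ t₂ →
      (if inN R (E₁ ⊠ᴱ E₂) (X₁ ⊠ X₂) (combine t₁ t₂) then (w₁ ⊗ʷ w₂) (combine t₁ t₂) else 0#)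
        ≈ covered₁ t₁ * covered₂ t₂
    term-factor t₁ t₂ = begin
      (if inN R (E₁ ⊠ᴱ E₂) (X₁ ⊠ X₂) (combine t₁ t₂) then (w₁ ⊗ʷ w₂) (combine t₁ t₂) else 0#)
        ≡⟨ ≡.cong₂ (λ b x → if b then x else 0#) (inN-⊠ R E₁ E₂ X₁ X₂ t₁ t₂)
                   (onPairs-combine (λ t₁ t₂ → w₁ t₁ * w₂ t₂) t₁ t₂) ⟩
      (if inN R E₁ X₁ t₁ ∧ inN R E₂ X₂ t₂ then w₁ t₁ * w₂ t₂ else 0#)
        ≈⟨ if-∧-* (inN R E₁ X₁ t₁) (inN R E₂ X₂ t₂) (w₁ t₁) (w₂ t₂) ⟩
      covered₁ t₁ * covered₂ t₂ ∎

open import Data.Nat using (_*_)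
open import Data.Product using (Σ; _×_)
open CommutativeSemiring using (Carrier; _≈_) renaming (_*_ to mul)

corollary3p15 : ∀ {c ℓ} (R : CommutativeSemiring c ℓ) →
    ∀ (n₁ n₂ : ℕ) (φ₁ : SubsetOf n₁ → Carrier R) (φ₂ : SubsetOf n₂ → Carrier R) →
    IsCoverage R φ₁ → IsCoverage R φ₂ →
    Σ (SubsetOf (n₁ * n₂) → Carrier R) λ φ →
      IsCoverage R φ × (∀ X₁ X₂ → _≈_ R (φ (X₁ ⊠ X₂)) (mul R (φ₁ X₁) (φ₂ X₂)))
corollary3p15 R n₁ n₂ φ₁ φ₂ (m₁ , E₁ , w₁ , φ₁≈) (m₂ , E₂ , w₂ , φ₂≈) =
  coverage R E w , (m₁ * m₂ , E , w , λ _ → R.refl) , factorises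
  where
  module R = CommutativeSemiring R
  open Tensor R using (_⊗ʷ_; coverage-⊠)

  E : Fin (n₁ * n₂) → Fin (m₁ * m₂) → Bool
  E = E₁ ⊠ᴱ E₂

  w : Fin (m₁ * m₂) → R.Carrier
  w = w₁ ⊗ʷ w₂

  factorises : ∀ X₁ X₂ → coverage R E w (X₁ ⊠ X₂) R.≈ φ₁ X₁ R.* φ₂ X₂
  factorises X₁ X₂ = R.trans (coverage-⊠ E₁ E₂ w₁ w₂ X₁ X₂) (R.sym (R.*-cong (φ₁≈ X₁) (φ₂≈ X₂)))
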